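{- Let $r$ be a rule. Then (1) $\to_r$ and $\mathit{ins}$ are compatible on terms: for all terms $s,s',t$ with $s'\in\mathit{ins}(s)$ and $s\to_r t$ there exists a term $t'\in\mathit{ins}(t)$ with $s'\to_r t'$; and (2) $\leadsto_r$ and $\mathit{mg}$ are compatible on goals: for all goals $\bar s,\bar s',\bar t$ with $\bar s'\in\mathit{mg}(\bar s)$ and $\bar s\leadsto_r \bar t$ there exists a goal $\bar t'\in\mathit{mg}(\bar t)$ with $\bar s'\leadsto_r \bar t'$.
   Context: Fix a signature $\Sigma$, a countably infinite set $X$ of variables and a fresh constant $\square$. Terms are elements of $T(\Sigma,X)$; goals are finite sequences $\langle s_1,\dots,s_n\rangle$ of terms. Substitutions (maps $X\to T(\Sigma,X)$ moving finitely many variables, applied homomorphically and componentwise to goals), renamings (bijective substitutions), positions $\mathit{Pos}(s)$, subterms $s|_p$, replacement $s[t]_p$ and most general unifiers are as usual. $t$ is an instance of $s$ (and $s$ more general than $t$) if $t=s\theta$ for some substitution $\theta$; likewise for goals. A context is a term over $\Sigma\cup\{\square\}$ containing at least one $\square$; $c[t]$ replaces all occurrences of $\square$ by $t$. A goal-context is a sequence $\langle s_1,\dots,s_i,\square,s_{i+1},\dots,s_n\rangle$ of terms with one hole; $\bar c[\bar t]$ replaces $\square$ by the elements of the goal $\bar t$. Define $\mathit{ins}(s)=\{c[t]\mid c \text{ context}, t \text{ instance of } s\}$ for terms, $\mathit{mg}(\bar s)=\{\bar c[\bar t]\mid \bar c \text{ goal-context}, \bar t \text{ more general than } \bar s\}$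 for goals. A rule is a pair $(u,\bar v)$, $u$ a term and $\bar v$ a goal. $s\to_{(r,p)} t$ iff $r=(u,\langle v\rangle)$, $p\in\mathit{Pos}(s)$, $s|_p=u\sigma$ for some substitution $\sigma$, $t=s[v\sigma]_p$; $\to_r=\bigcup_p\to_{(r,p)}$. For goals, $\bar s\leadsto_{(r,\langle i\rangle)}\bar t$ iff $\bar s=\langle s_1,\dots,s_n\rangle$, $1\le i\le n$, and there are a renaming $\gamma$ with $(u',\langle v_1,\dots,v_m\rangle)=(u\gamma,\bar v\gamma)$ variable-disjoint from $\bar s$ (where $r=(u,\bar v)$) and a most general unifier $\sigma$ of $s_i$ and $u'$ with $\bar t=\langle s_1,\dots,s_{i-1},v_1,\dots,v_m,s_{i+1},\dots,s_n\rangle\sigma$; $\leadsto_r=\bigcup_i\leadsto_{(r,\langle i\rangle)}$. -}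

module Defs where

open import Data.Nat using (ℕ; _≤_; _+_)
open import Data.Sum using (_⊎_)
open import Data.Fin using (Fin; toℕ)
open import Data.Maybe using (Maybe; just; nothing)
open import Data.List using (List; []; _∷_; _++_; [_]; length) renaming (map to lmap)
open import Data.List.Relation.Unary.Any as LAny using ()
open import Data.Vec using (Vec; []; _∷_; lookup; _[_]≔_)
open import Data.Vec.Relation.Unary.Any as VAny using ()
open import Data.Product using (Σ; ∃; _×_; _,_; proj₁)
open import Relation.Binary.PropositionalEquality using (_≡_)
open import Relation.Nullary using (¬_)

record Signature : Set₁ where
  field
    Sym : Set
    ar  : Sym → ℕ
open Signature public

data Term (S : Signature) : Set where
  var : ℕ → Term S
  fun : (f : Sym S) → Vec (Term S) (ar S f) → Term S

data Occ {S : Signature} (x : ℕ) : Term S → Set where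
  here   : Occ x (var x)
  inside : ∀ {f ts} → VAny.Any (Occ x) ts → Occ x (fun f ts)

OccG : {S : Signature} → ℕ → List (Term S) → Set
OccG x g = LAny.Any (Occ x) g

Subst : Signature → Set
Subst S = Σ (ℕ → Term S) λ σ → ∃ λ N → ∀ x → N ≤ x → σ x ≡ var x

module _ {S : Signature} (σ : ℕ → Term S) where
  mutual
    app : Term S → Term S
    app (var x)    = σ x
    app (fun f ts) = fun f (appV ts)

    appV : ∀ {n} → Vec (Term S) n → Vec (Term S) n
    appV []       = []
    appV (t ∷ ts) = app t ∷ appV ts

infixl 8 _⟨_⟩ _⟪_⟫
_⟨_⟩ : {S : Signature} → Term S → Subst S → Term S
t ⟨ σ ⟩ = app (proj₁ σ) t

_⟪_⟫ : {S : Signature} → List (Term S) → Subst S → List (Term S)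
g ⟪ σ ⟫ = lmap (_⟨ σ ⟩) g

IsRenaming : {S : Signature} → Subst S → Set
IsRenaming {S} γ =
  (∀ (s t : Term S) → s ⟨ γ ⟩ ≡ t ⟨ γ ⟩ → s ≡ t) ×
  (∀ (t : Term S) → ∃ λ s → s ⟨ γ ⟩ ≡ t)

_InstanceOf_ : {S : Signature} → Term S → Term S → Set
_InstanceOf_ {S} t s = ∃ λ (θ : Subst S) → t ≡ s ⟨ θ ⟩

_GoalInstanceOf_ : {S : Signature} → List (Term S) → List (Term S) → Set
_GoalInstanceOf_ {S} t s = ∃ λ (θ : Subst S) → t ≡ s ⟪ θ ⟫

-- Contexts: terms over Σ ∪ {□}, □ a fresh constant, with ≥ 1 hole

_⁺ : Signature → Signature
S ⁺ = record { Sym = Maybe (Sym S) ; ar = ar⁺ }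
  where
  ar⁺ : Maybe (Sym S) → ℕ
  ar⁺ (just f) = ar S f
  ar⁺ nothing  = 0

□ : {S : Signature} → Term (S ⁺)
□ = fun nothing []

data HasHole {S : Signature} : Term (S ⁺) → Set where
  hole   : HasHole □
  inside : ∀ {f cs} → VAny.Any HasHole cs → HasHole (fun (just f) cs)

Context : Signature → Set
Context S = Σ (Term (S ⁺)) HasHole

module _ {S : Signature} (t : Term S) where
  mutual
    fill : Term (S ⁺) → Term S
    fill (var x)           = var x
    fill (fun nothing _)   = t
    fill (fun (just f) cs) = fun f (fillV cs)

    fillV : ∀ {n} → Vec (Term (S ⁺)) n → Vec (Term S) n
    fillV []       = []
    fillV (c ∷ cs) = fill c ∷ fillV cs

_[_]ᶜ : {S : Signature} → Context S → Term S → Term S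
c [ t ]ᶜ = fill t (proj₁ c)

_∈ins_ : {S : Signature} → Term S → Term S → Set
_∈ins_ {S} s' s = ∃ λ (c : Context S) → ∃ λ (t : Term S) → t InstanceOf s × s' ≡ c [ t ]ᶜ

-- goal-contexts ⟨s₁,…,sᵢ,□,sᵢ₊₁,…,sₙ⟩ represented by (prefix, suffix);
-- filling with a goal t̄ gives prefix ++ t̄ ++ suffix.
GoalContext : Signature → Set
GoalContext S = List (Term S) × List (Term S)

_[_]ᵍ : {S : Signature} → GoalContext S → List (Term S) → List (Term S)
(pre , post) [ t ]ᵍ = pre ++ t ++ post

_∈mg_ : {S : Signature} → List (Term S) → List (Term S) → Set
_∈mg_ {S} s' s = ∃ λ (c : GoalContext S) → ∃ λ (t : List (Term S)) →
  s GoalInstanceOf t × s' ≡ c [ t ]ᵍ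

-- Positions, subterms and replacement.
-- Replace s p old new s'  ⇔  p ∈ Pos(s), s|_p = old and s[new]_p = s'.

Pos : Set
Pos = List ℕ

data Replace {S : Signature} : Term S → Pos → Term S → Term S → Term S → Set where
  root  : ∀ {s new} → Replace s [] s new new
  below : ∀ {f ts p old new t'} (i : Fin (ar S f)) →
          Replace (lookup ts i) p old new t' →
          Replace (fun f ts) (toℕ i ∷ p) old new (fun f (ts [ i ]≔ t'))

Rule : Signature → Set
Rule S = Term S × List (Term S)

Step : {S : Signature} → Rule S → Pos → Term S → Term S → Set
Step {S} (u , v̄) p s t = ∃ λ v → v̄ ≡ [ v ] ×
  ∃ λ (σ : Subst S) → Replace s p (u ⟨ σ ⟩) (v ⟨ σ ⟩) t

_⊢_⟶_ : {S : Signature} → Rule S → Term S → Term S → Set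
r ⊢ s ⟶ t = ∃ λ p → Step r p s t

IsUnifier : {S : Signature} → Subst S → Term S → Term S → Set
IsUnifier σ s t = s ⟨ σ ⟩ ≡ t ⟨ σ ⟩

IsMGU : {S : Signature} → Subst S → Term S → Term S → Set
IsMGU {S} σ s t = IsUnifier σ s t ×
  (∀ (θ : Subst S) → IsUnifier θ s t →
     ∃ λ (δ : Subst S) → ∀ x → proj₁ θ x ≡ proj₁ σ x ⟨ δ ⟩)

VarDisjoint : {S : Signature} → Rule S → List (Term S) → Set
VarDisjoint (u , v̄) s̄ = ∀ x → (Occ x u ⊎ OccG x v̄) → ¬ OccG x s̄

NarrowAt : {S : Signature} → Rule S → ℕ → List (Term S) → List (Term S) → Set
NarrowAt {S} (u , v̄) i s̄ t̄ =
  ∃ λ (pre : List (Term S)) → ∃ λ (sᵢ : Term S) → ∃ λ (post : List (Term S)) →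
  s̄ ≡ pre ++ sᵢ ∷ post × i ≡ length pre + 1 ×
  ∃ λ (γ : Subst S) → IsRenaming γ × VarDisjoint (u ⟨ γ ⟩ , v̄ ⟪ γ ⟫) s̄ ×
  ∃ λ (σ : Subst S) → IsMGU σ sᵢ (u ⟨ γ ⟩) ×
  t̄ ≡ (pre ++ v̄ ⟪ γ ⟫ ++ post) ⟪ σ ⟫

_⊢_⇝_ : {S : Signature} → Rule S → List (Term S) → List (Term S) → Set
r ⊢ s̄ ⇝ t̄ = ∃ λ i → NarrowAt r i s̄ t̄

-- Rewriting: if s′ = c[sθ] and s rewrites at p with matcher σ, pick one hole of c, at position q,
-- and fill the other holes with sθ; then s′ rewrites at q·p with matcher σθ, giving an element of
-- ins(t).
--
-- Narrowing: let s̄′ = c̄[ḡ] with ḡθ = s̄, and let s̄ narrow at sᵢ = gᵢθ with renaming γ and mgu σ.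
-- Choose M above every variable of s̄′ and of the rule, and rename the rule apart by swapping the
-- variable blocks [0, M) and [M, 2M). The substitution τ that acts as θσ below M and as γσ on
-- [M, 2M) unifies gᵢ with the renamed left-hand side, so unification yields an mgu σ′ with
-- τ = σ′τ. Narrowing s̄′ at gᵢ with σ′ gives c̄σ′[ḡ′σ′], where ḡ′ is ḡ with gᵢ narrowed, and
-- ḡ′σ′τ = ḡ′τ = t̄.

module Submission where

open import Defs
open import Data.Product using (_×_; ∃)
open import Data.List using (List)

open import Function using (_∘_; _⇔_; mk⇔; Equivalence)
open import Data.Empty using (⊥-elim)
open import Data.Nat using (ℕ; suc; z≤n; _+_; _∸_; _≤_; _<_; s≤s)
open import Data.Nat.Properties
open import Data.Nat.Induction using (<-wellFounded)
open import Data.Nat.Tactic.RingSolver using (solve-∀)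
open import Data.Fin using (Fin; toℕ; zero; suc)
open import Data.Maybe using (just)
open import Data.Product using (Σ; _,_; proj₁; proj₂)
open import Data.Product.Relation.Binary.Lex.Strict using (×-Lex; ×-wellFounded)
open import Data.Sum using (_⊎_; inj₁; inj₂)
import Data.Sum as Sum
open import Data.List using ([]; _∷_; _++_; [_]; length; map; concatMap; filter)
open import Data.List.Properties using (map-++; map-∘; map-cong; map-cong-local; ++-assoc; filter-notAll; ∷-injectiveˡ; ∷-injectiveʳ)
open import Data.List.Extrema.Nat using (max; xs≤max)
open import Data.List.Membership.Propositional using (_∈_; _∉_)
open import Data.List.Membership.Propositional.Properties using (∈-++⁺ˡ; ∈-++⁺ʳ; ∈-filter⁺; ∈-filter⁻)
open import Data.List.Relation.Unary.Any as Any using (Any; here; there)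
import Data.List.Relation.Unary.Any.Properties as Any
open import Data.List.Relation.Unary.All as All using (All; []; _∷_)
import Data.List.Relation.Unary.All.Properties as All
open import Data.Vec using (Vec; []; _∷_; lookup; _[_]≔_)
open import Data.Vec.Relation.Unary.Any as VAny using (here; there)
import Data.Vec.Properties as Vec
open import Induction.WellFounded using (Acc; acc)
open import Relation.Binary.PropositionalEquality using (_≡_; _≢_; refl; sym; trans; cong; cong₂; subst; subst₂; module ≡-Reasoning)
open import Relation.Nullary using (¬_; yes; no; ¬?; Dec)

private
  variable
    A B : Set

map-≡-++-∷ : ∀ (f : A → B) xs {ys y zs} → map f xs ≡ ys ++ y ∷ zs →
  ∃ λ xs₁ → ∃ λ x → ∃ λ xs₂ →
    xs ≡ xs₁ ++ x ∷ xs₂ × map f xs₁ ≡ ys × f x ≡ y × map f xs₂ ≡ zs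
map-≡-++-∷ f (x ∷ xs) {[]}    refl = [] , x , xs , refl , refl , refl , refl
map-≡-++-∷ f (x ∷ xs) {_ ∷ _} eq with map-≡-++-∷ f xs (∷-injectiveʳ eq)
... | xs₁ , x′ , xs₂ , refl , refl , refl , refl =
  x ∷ xs₁ , x′ , xs₂ , refl , cong (_∷ _) (∷-injectiveˡ eq) , refl , refl

++-reassoc : ∀ (a b c d e : List A) → (a ++ b) ++ c ++ d ++ e ≡ a ++ (b ++ c ++ d) ++ e
++-reassoc a b c d e = begin
  (a ++ b) ++ c ++ d ++ e     ≡⟨ ++-assoc a b _ ⟩
  a ++ b ++ c ++ d ++ e       ≡⟨ cong (a ++_) (cong (b ++_) (++-assoc c d e)) ⟨
  a ++ b ++ (c ++ d) ++ e     ≡⟨ cong (a ++_) (++-assoc b (c ++ d) e) ⟨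
  a ++ (b ++ c ++ d) ++ e     ∎
  where open ≡-Reasoning

map-++₃ : ∀ (f : A → B) xs ys zs → map f (xs ++ ys ++ zs) ≡ map f xs ++ map f ys ++ map f zs
map-++₃ f xs ys zs = trans (map-++ f xs (ys ++ zs)) (cong (map f xs ++_) (map-++ f ys zs))

bound : List ℕ → ℕ
bound xs = suc (max 0 xs)

∈⇒<bound : ∀ {x xs} → x ∈ xs → x < bound xs
∈⇒<bound {xs = xs} x∈xs = s≤s (All.lookup (xs≤max 0 xs) x∈xs)

module _ {S : Signature} where

  infixl 9 _⨾_
  _⨾_ : (ℕ → Term S) → (ℕ → Term S) → ℕ → Term S
  (σ ⨾ θ) x = app θ (σ x)

  mutual
    app-cong : ∀ {σ θ : ℕ → Term S} t → (∀ {x} → Occ x t → σ x ≡ θ x) → app σ t ≡ app θ t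
    app-cong (var x)    eq = eq here
    app-cong (fun f ts) eq = cong (fun f) (appV-cong ts (λ o → eq (inside o)))

    appV-cong : ∀ {n} {σ θ : ℕ → Term S} (ts : Vec (Term S) n) →
      (∀ {x} → VAny.Any (Occ x) ts → σ x ≡ θ x) → appV σ ts ≡ appV θ ts
    appV-cong []       eq = refl
    appV-cong (t ∷ ts) eq = cong₂ _∷_ (app-cong t (λ o → eq (here o))) (appV-cong ts (λ o → eq (there o)))

  mutual
    app-⨾ : ∀ (σ θ : ℕ → Term S) t → app (σ ⨾ θ) t ≡ app θ (app σ t)
    app-⨾ σ θ (var x)    = refl
    app-⨾ σ θ (fun f ts) = cong (fun f) (appV-⨾ σ θ ts)

    appV-⨾ : ∀ {n} (σ θ : ℕ → Term S) (ts : Vec (Term S) n) → appV (σ ⨾ θ) ts ≡ appV θ (appV σ ts)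
    appV-⨾ σ θ []       = refl
    appV-⨾ σ θ (t ∷ ts) = cong₂ _∷_ (app-⨾ σ θ t) (appV-⨾ σ θ ts)

  mutual
    app-var : ∀ t → app var t ≡ t
    app-var (var x)    = refl
    app-var (fun f ts) = cong (fun f) (appV-var ts)

    appV-var : ∀ {n} (ts : Vec (Term S) n) → appV var ts ≡ ts
    appV-var []       = refl
    appV-var (t ∷ ts) = cong₂ _∷_ (app-var t) (appV-var ts)

  mutual
    Occ-app⁻ : ∀ (ρ : ℕ → Term S) t {y} → Occ y (app ρ t) → ∃ λ z → Occ z t × Occ y (ρ z)
    Occ-app⁻ ρ (var x)    o          = x , here , o
    Occ-app⁻ ρ (fun f ts) (inside o) with OccV-app⁻ ρ ts o
    ... | z , z∈ts , y∈ρz = z , inside z∈ts , y∈ρz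

    OccV-app⁻ : ∀ {n} (ρ : ℕ → Term S) (ts : Vec (Term S) n) {y} →
      VAny.Any (Occ y) (appV ρ ts) → ∃ λ z → VAny.Any (Occ z) ts × Occ y (ρ z)
    OccV-app⁻ ρ (t ∷ ts) (here o) with Occ-app⁻ ρ t o
    ... | z , z∈t , y∈ρz = z , here z∈t , y∈ρz
    OccV-app⁻ ρ (t ∷ ts) (there o) with OccV-app⁻ ρ ts o
    ... | z , z∈ts , y∈ρz = z , there z∈ts , y∈ρz

  infixl 9 _⨾ˢ_
  _⨾ˢ_ : Subst S → Subst S → Subst S
  (σ , M , σ-fix) ⨾ˢ (θ , N , θ-fix) = σ ⨾ θ , M + N , λ x M+N≤x →
    trans (cong (app θ) (σ-fix x (≤-trans (m≤m+n M N) M+N≤x))) (θ-fix x (≤-trans (m≤n+m N M) M+N≤x))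

  lookup-appV : ∀ {n} (ρ : ℕ → Term S) (ts : Vec (Term S) n) i → lookup (appV ρ ts) i ≡ app ρ (lookup ts i)
  lookup-appV ρ (t ∷ ts) zero    = refl
  lookup-appV ρ (t ∷ ts) (suc i) = lookup-appV ρ ts i

  appV-[]≔ : ∀ {n} (ρ : ℕ → Term S) (ts : Vec (Term S) n) i t → appV ρ (ts [ i ]≔ t) ≡ appV ρ ts [ i ]≔ app ρ t
  appV-[]≔ ρ (t′ ∷ ts) zero    t = refl
  appV-[]≔ ρ (t′ ∷ ts) (suc i) t = cong (app ρ t′ ∷_) (appV-[]≔ ρ ts i t)

  Replace-app : ∀ (ρ : ℕ → Term S) {s p a b t} → Replace s p a b t →
    Replace (app ρ s) p (app ρ a) (app ρ b) (app ρ t)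
  Replace-app ρ root = root
  Replace-app ρ {fun f ts} (below {t' = t′} i R) =
    subst (λ ts′ → Replace _ _ _ _ (fun f ts′)) (sym (appV-[]≔ ρ ts i t′))
      (below i (subst (λ s → Replace s _ _ _ _) (sym (lookup-appV ρ ts i)) (Replace-app ρ R)))

  Replace-++ : ∀ {s q a b t p c d} → Replace {S} s q a b t → Replace a p c d b → Replace s (q ++ p) c d t
  Replace-++ root        R′ = R′
  Replace-++ (below i R) R′ = below i (Replace-++ R R′)

  mutual
    lift : Term S → Term (S ⁺)
    lift (var x)    = var x
    lift (fun f ts) = fun (just f) (liftV ts)

    liftV : ∀ {n} → Vec (Term S) n → Vec (Term (S ⁺)) n
    liftV []       = []
    liftV (t ∷ ts) = lift t ∷ liftV ts

  mutual
    fill-lift : ∀ a t → fill a (lift t) ≡ t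
    fill-lift a (var x)    = refl
    fill-lift a (fun f ts) = cong (fun f) (fillV-lift a ts)

    fillV-lift : ∀ {n} a (ts : Vec (Term S) n) → fillV a (liftV ts) ≡ ts
    fillV-lift a []       = refl
    fillV-lift a (t ∷ ts) = cong₂ _∷_ (fill-lift a t) (fillV-lift a ts)

  -- The new context keeps the chosen hole and fills all other holes of c with a.
  mutual
    Replace-fill : ∀ a b {c} → HasHole c → ∃ λ q → ∃ λ (c′ : Context S) → Replace (fill a c) q a b (c′ [ b ]ᶜ)
    Replace-fill a b hole = [] , (□ , hole) , root
    Replace-fill a b (inside {f} {cs} h) with Replace-fillV a b cs h
    ... | i , q , cs′ , h′ , t′ , R , cs′[b]≡ =
      toℕ i ∷ q , (fun (just f) cs′ , inside h′) ,
      subst (λ ts → Replace _ _ a b (fun f ts)) (sym cs′[b]≡) (below i R)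

    Replace-fillV : ∀ a b {n} (cs : Vec (Term (S ⁺)) n) → VAny.Any HasHole cs →
      ∃ λ (i : Fin n) → ∃ λ q → ∃ λ (cs′ : Vec (Term (S ⁺)) n) → VAny.Any HasHole cs′ ×
        ∃ λ t′ → Replace (lookup (fillV a cs) i) q a b t′ × fillV b cs′ ≡ fillV a cs [ i ]≔ t′
    Replace-fillV a b (c ∷ cs) (here h) with Replace-fill a b h
    ... | q , (c′ , h′) , R =
      zero , q , c′ ∷ liftV (fillV a cs) , here h′ , fill b c′ , R , cong (fill b c′ ∷_) (fillV-lift b (fillV a cs))
    Replace-fillV a b (c ∷ cs) (there h) with Replace-fillV a b cs h
    ... | i , q , cs′ , h′ , t′ , R , eq =
      suc i , q , lift (fill a c) ∷ cs′ , there h′ , t′ , R , cong₂ _∷_ (fill-lift b (fill a c)) eq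

  ⟶-compatible-ins : (r : Rule S) (s s′ t : Term S) → s′ ∈ins s → r ⊢ s ⟶ t →
    ∃ λ (t′ : Term S) → t′ ∈ins t × r ⊢ s′ ⟶ t′
  ⟶-compatible-ins (u , _) s _ t ((c , c-hole) , _ , (θ , refl) , refl) (p , v , refl , σ , R)
    with Replace-fill (s ⟨ θ ⟩) (t ⟨ θ ⟩) c-hole
  ... | q , c′ , R′ =
    c′ [ t ⟨ θ ⟩ ]ᶜ , (c′ , t ⟨ θ ⟩ , (θ , refl) , refl) ,
    q ++ p , v , refl , σ ⨾ˢ θ ,
    subst₂ (λ a b → Replace _ _ a b _) (sym (app-⨾ _ _ u)) (sym (app-⨾ _ _ v))
      (Replace-++ R′ (Replace-app (proj₁ θ) R))

  mutual
    vars : Term S → List ℕ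
    vars (var x)    = [ x ]
    vars (fun f ts) = varsV ts

    varsV : ∀ {n} → Vec (Term S) n → List ℕ
    varsV []       = []
    varsV (t ∷ ts) = vars t ++ varsV ts

  mutual
    Occ⇒∈vars : ∀ {x} t → Occ x t → x ∈ vars t
    Occ⇒∈vars (var x)    here       = here refl
    Occ⇒∈vars (fun f ts) (inside o) = OccV⇒∈varsV ts o

    OccV⇒∈varsV : ∀ {x n} (ts : Vec (Term S) n) → VAny.Any (Occ x) ts → x ∈ varsV ts
    OccV⇒∈varsV (t ∷ ts) (here o)  = ∈-++⁺ˡ (Occ⇒∈vars t o)
    OccV⇒∈varsV (t ∷ ts) (there o) = ∈-++⁺ʳ (vars t) (OccV⇒∈varsV ts o)

  mutual
    Occ? : ∀ x t → Dec (Occ {S} x t)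
    Occ? x (var y) with x ≟ y
    ... | yes refl = yes here
    ... | no x≢y   = no λ { here → x≢y refl }
    Occ? x (fun f ts) with OccV? x ts
    ... | yes o = yes (inside o)
    ... | no ¬o = no λ { (inside o) → ¬o o }

    OccV? : ∀ {n} x (ts : Vec (Term S) n) → Dec (VAny.Any (Occ x) ts)
    OccV? x []       = no λ ()
    OccV? x (t ∷ ts) with Occ? x t | OccV? x ts
    ... | yes o | _     = yes (here o)
    ... | no _  | yes o = yes (there o)
    ... | no ¬p | no ¬q = no λ { (here o) → ¬p o ; (there o) → ¬q o }

  mutual
    size : Term S → ℕ
    size (var x)    = 1
    size (fun f ts) = suc (sizeV ts)

    sizeV : ∀ {n} → Vec (Term S) n → ℕ
    sizeV []       = 0
    sizeV (t ∷ ts) = size t + sizeV ts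

  mutual
    Occ⇒size≤ : ∀ (ρ : ℕ → Term S) {x} t → Occ x t → size (ρ x) ≤ size (app ρ t)
    Occ⇒size≤ ρ (var x)    here       = ≤-refl
    Occ⇒size≤ ρ (fun f ts) (inside o) = m≤n⇒m≤1+n (OccV⇒size≤ ρ ts o)

    OccV⇒size≤ : ∀ {n} (ρ : ℕ → Term S) {x} (ts : Vec (Term S) n) → VAny.Any (Occ x) ts → size (ρ x) ≤ sizeV (appV ρ ts)
    OccV⇒size≤ ρ (t ∷ ts) (here o)  = ≤-trans (Occ⇒size≤ ρ t o) (m≤m+n _ _)
    OccV⇒size≤ ρ (t ∷ ts) (there o) = ≤-trans (OccV⇒size≤ ρ ts o) (m≤n+m _ _)

  occurs-check : ∀ (ρ : ℕ → Term S) {x t} → Occ x t → ρ x ≡ app ρ t → t ≡ var x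
  occurs-check ρ here       _  = refl
  occurs-check ρ (inside o) eq = ⊥-elim (<-irrefl (cong size eq) (s≤s (OccV⇒size≤ ρ _ o)))

  fun-injectiveˡ : ∀ {f g} {ss : Vec (Term S) (ar S f)} {ts : Vec (Term S) (ar S g)} → fun f ss ≡ fun g ts → f ≡ g
  fun-injectiveˡ refl = refl

  fun-injectiveʳ : ∀ {f} {ss ts : Vec (Term S) (ar S f)} → fun f ss ≡ fun f ts → ss ≡ ts
  fun-injectiveʳ refl = refl

  Equation : Set
  Equation = Term S × Term S

  infix 4 _Unifies_ _⊑_
  _Unifies_ : (ℕ → Term S) → List Equation → Set
  θ Unifies E = All (λ e → app θ (proj₁ e) ≡ app θ (proj₂ e)) E

  OccE : ℕ → List Equation → Set
  OccE x E = Any (λ e → Occ x (proj₁ e) ⊎ Occ x (proj₂ e)) E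

  VarsWithin : List ℕ → List Equation → Set
  VarsWithin V E = ∀ {x} → OccE x E → x ∈ V

  _⟦_⟧ : List Equation → (ℕ → Term S) → List Equation
  E ⟦ ρ ⟧ = map (λ e → app ρ (proj₁ e) , app ρ (proj₂ e)) E

  -- θ = σ ⨾ θ: the strong form of "σ is more general than θ" enjoyed by idempotent mgus.
  _⊑_ : (σ θ : ℕ → Term S) → Set
  σ ⊑ θ = ∀ x → θ x ≡ app θ (σ x)

  ⊑⇒app-⨾ : ∀ {σ θ} → σ ⊑ θ → ∀ t → app (σ ⨾ θ) t ≡ app θ t
  ⊑⇒app-⨾ σ⊑θ t = app-cong t (λ {x} _ → sym (σ⊑θ x))

  ⊑-app : ∀ {σ θ} → σ ⊑ θ → ∀ t → app θ (app σ t) ≡ app θ t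
  ⊑-app {σ} {θ} σ⊑θ t = trans (sym (app-⨾ σ θ t)) (⊑⇒app-⨾ {σ} σ⊑θ t)

  ⊑-⨾ : ∀ {ρ σ θ} → ρ ⊑ θ → σ ⊑ θ → ρ ⨾ σ ⊑ θ
  ⊑-⨾ {ρ} {σ} ρ⊑θ σ⊑θ x = trans (ρ⊑θ x) (sym (⊑-app {σ} σ⊑θ (ρ x)))

  Unifies-⟦⟧ : ∀ {θ ρ} E → θ Unifies E ⟦ ρ ⟧ ⇔ ρ ⨾ θ Unifies E
  Unifies-⟦⟧ {θ} {ρ} E = mk⇔
    (All.map (λ {e} eq → trans (app-⨾ ρ θ (proj₁ e)) (trans eq (sym (app-⨾ ρ θ (proj₂ e))))) ∘ All.map⁻)
    (All.map⁺ ∘ All.map (λ {e} eq → trans (sym (app-⨾ ρ θ (proj₁ e))) (trans eq (app-⨾ ρ θ (proj₂ e)))))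

  ⊑-Unifies-⟦⟧ : ∀ {θ ρ} E → ρ ⊑ θ → θ Unifies E → θ Unifies E ⟦ ρ ⟧
  ⊑-Unifies-⟦⟧ {ρ = ρ} E ρ⊑θ θ-unifies = Equivalence.from (Unifies-⟦⟧ E)
    (All.map (λ {e} eq → trans (⊑⇒app-⨾ {ρ} ρ⊑θ (proj₁ e)) (trans eq (sym (⊑⇒app-⨾ {ρ} ρ⊑θ (proj₂ e))))) θ-unifies)

  OccE-⟦⟧⁻ : ∀ (ρ : ℕ → Term S) E {y} → OccE y (E ⟦ ρ ⟧) → ∃ λ z → OccE z E × Occ y (ρ z)
  OccE-⟦⟧⁻ ρ (e ∷ E) (here (inj₁ o)) with Occ-app⁻ ρ (proj₁ e) o
  ... | z , z∈e , y∈ρz = z , here (inj₁ z∈e) , y∈ρz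
  OccE-⟦⟧⁻ ρ (e ∷ E) (here (inj₂ o)) with Occ-app⁻ ρ (proj₂ e) o
  ... | z , z∈e , y∈ρz = z , here (inj₂ z∈e) , y∈ρz
  OccE-⟦⟧⁻ ρ (e ∷ E) (there o) with OccE-⟦⟧⁻ ρ E o
  ... | z , z∈E , y∈ρz = z , there z∈E , y∈ρz

  record MGUWithin (V : List ℕ) (E : List Equation) : Set where
    field
      mgu         : ℕ → Term S
      unifies     : mgu Unifies E
      mostGeneral : ∀ θ → θ Unifies E → mgu ⊑ θ
      support     : ∀ {y} → y ∉ V → mgu y ≡ var y

  MGUWithin-[] : ∀ {V} → MGUWithin V []
  MGUWithin-[] = record { mgu = var ; unifies = [] ; mostGeneral = λ _ _ _ → refl ; support = λ _ → refl }

  MGUWithin-⇔ : ∀ {V E E′} → (∀ θ → θ Unifies E ⇔ θ Unifies E′) → MGUWithin V E → MGUWithin V E′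
  MGUWithin-⇔ E⇔E′ m = record
    { mgu         = mgu
    ; unifies     = Equivalence.to (E⇔E′ mgu) unifies
    ; mostGeneral = λ θ → mostGeneral θ ∘ Equivalence.from (E⇔E′ θ)
    ; support     = support
    }
    where open MGUWithin m

  Unifies-delete : ∀ {θ} a E → θ Unifies E ⇔ θ Unifies (a , a) ∷ E
  Unifies-delete a E = mk⇔ (refl ∷_) All.tail

  Unifies-swap : ∀ {θ} a b E → θ Unifies (a , b) ∷ E ⇔ θ Unifies (b , a) ∷ E
  Unifies-swap a b E = mk⇔ swap swap
    where
    swap : ∀ {θ a b} → θ Unifies (a , b) ∷ E → θ Unifies (b , a) ∷ E
    swap (eq ∷ eqs) = sym eq ∷ eqs

  OccE-swap : ∀ {x} a b E → OccE x ((b , a) ∷ E) → OccE x ((a , b) ∷ E)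
  OccE-swap a b E (here o)  = here (Sum.swap o)
  OccE-swap a b E (there o) = there o

  zipEq : ∀ {n} → Vec (Term S) n → Vec (Term S) n → List Equation
  zipEq []       []       = []
  zipEq (s ∷ ss) (t ∷ ts) = (s , t) ∷ zipEq ss ts

  Unifies-zipEq : ∀ {θ n} (ss ts : Vec (Term S) n) → appV θ ss ≡ appV θ ts ⇔ θ Unifies zipEq ss ts
  Unifies-zipEq ss ts = mk⇔ (to ss ts) (from ss ts)
    where
    to : ∀ {θ n} (ss ts : Vec (Term S) n) → appV θ ss ≡ appV θ ts → θ Unifies zipEq ss ts
    to []       []       eq = []
    to (s ∷ ss) (t ∷ ts) eq = Vec.∷-injectiveˡ eq ∷ to ss ts (Vec.∷-injectiveʳ eq)
    from : ∀ {θ n} (ss ts : Vec (Term S) n) → θ Unifies zipEq ss ts → appV θ ss ≡ appV θ ts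
    from []       []       []         = refl
    from (s ∷ ss) (t ∷ ts) (eq ∷ eqs) = cong₂ _∷_ eq (from ss ts eqs)

  Unifies-decompose : ∀ {θ f} (ss ts : Vec (Term S) (ar S f)) E →
    θ Unifies zipEq ss ts ++ E ⇔ θ Unifies (fun f ss , fun f ts) ∷ E
  Unifies-decompose ss ts E = mk⇔
    (λ eqs → let eqs₁ , eqs₂ = All.++⁻ (zipEq ss ts) eqs
             in cong (fun _) (Equivalence.from (Unifies-zipEq ss ts) eqs₁) ∷ eqs₂)
    (λ { (eq ∷ eqs) → All.++⁺ (Equivalence.to (Unifies-zipEq ss ts) (fun-injectiveʳ eq)) eqs })

  OccE-decompose : ∀ {x f} (ss ts : Vec (Term S) (ar S f)) E →
    OccE x (zipEq ss ts ++ E) → OccE x ((fun f ss , fun f ts) ∷ E)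
  OccE-decompose ss ts E o with Any.++⁻ (zipEq ss ts) o
  ... | inj₁ o′ = here (Sum.map inside inside (zipped ss ts o′))
    where
    zipped : ∀ {x n} (ss ts : Vec (Term S) n) → OccE x (zipEq ss ts) →
      VAny.Any (Occ x) ss ⊎ VAny.Any (Occ x) ts
    zipped []       []       ()
    zipped (s ∷ ss) (t ∷ ts) (here o)  = Sum.map here here o
    zipped (s ∷ ss) (t ∷ ts) (there o) = Sum.map there there (zipped ss ts o)
  ... | inj₂ o′ = there o′

  _↦_ : ℕ → Term S → ℕ → Term S
  (x ↦ t) y with x ≟ y
  ... | yes _ = t
  ... | no _  = var y

  ↦-same : ∀ x t → (x ↦ t) x ≡ t
  ↦-same x t with x ≟ x
  ... | yes _  = refl
  ... | no x≢x = ⊥-elim (x≢x refl)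

  ↦-other : ∀ {x y} t → x ≢ y → (x ↦ t) y ≡ var y
  ↦-other {x} {y} t x≢y with x ≟ y
  ... | yes x≡y = ⊥-elim (x≢y x≡y)
  ... | no _    = refl

  ↦-⊑ : ∀ {θ} x t → θ x ≡ app θ t → (x ↦ t) ⊑ θ
  ↦-⊑ x t θx≡θt y with x ≟ y
  ... | yes refl = θx≡θt
  ... | no _     = refl

  app-↦-fresh : ∀ {x} t a → ¬ Occ x a → app (x ↦ t) a ≡ a
  app-↦-fresh t a x∉a = trans (app-cong a (λ o → ↦-other t (λ { refl → x∉a o }))) (app-var a)

  sizeE : List Equation → ℕ
  sizeE []            = 0
  sizeE ((a , b) ∷ E) = size a + size b + sizeE E

  size>0 : ∀ t → 0 < size t
  size>0 (var x)    = s≤s z≤n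
  size>0 (fun f ts) = s≤s z≤n

  sizeE-tail : ∀ a b E → sizeE E < sizeE ((a , b) ∷ E)
  sizeE-tail a b E = m<n+m (sizeE E) (<-≤-trans (size>0 a) (m≤m+n (size a) (size b)))

  sizeE-decompose : ∀ {f} (ss ts : Vec (Term S) (ar S f)) E →
    sizeE (zipEq ss ts ++ E) < sizeE ((fun f ss , fun f ts) ∷ E)
  sizeE-decompose ss ts E = begin-strict
    sizeE (zipEq ss ts ++ E)          ≡⟨ sizeE-zipEq ss ts ⟩
    sizeV ss + sizeV ts + sizeE E     <⟨ +-monoˡ-< (sizeE E) (+-monoʳ-< (sizeV ss) (n<1+n (sizeV ts))) ⟩
    sizeV ss + suc (sizeV ts) + sizeE E ≤⟨ +-monoˡ-≤ (sizeE E) (n≤1+n _) ⟩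
    suc (sizeV ss) + suc (sizeV ts) + sizeE E ∎
    where
    open ≤-Reasoning
    sizeE-zipEq : ∀ {n} (ss ts : Vec (Term S) n) → sizeE (zipEq ss ts ++ E) ≡ sizeV ss + sizeV ts + sizeE E
    sizeE-zipEq []       []       = refl
    sizeE-zipEq (s ∷ ss) (t ∷ ts) =
      trans (cong (size s + size t +_) (sizeE-zipEq ss ts)) (shuffle (size s) (size t) (sizeV ss) (sizeV ts) (sizeE E))
      where
      shuffle : ∀ a b c d e → a + b + (c + d + e) ≡ a + c + (b + d) + e
      shuffle = solve-∀

  -- The unifier τ is only needed to rule out clashes and occurs-check failures, so that
  -- no decidable equality of function symbols is required.
  module Unify (τ : ℕ → Term S) where

    eliminate : ∀ {V x t E} → ¬ Occ x t → VarsWithin V ((var x , t) ∷ E) → τ Unifies (var x , t) ∷ E →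
      (∀ {V′} E′ → length V′ < length V → VarsWithin V′ E′ → τ Unifies E′ → MGUWithin V′ E′) →
      MGUWithin V ((var x , t) ∷ E)
    eliminate {V} {x} {t} {E} x∉t within (τx≡τt ∷ τ-unifies) recurse = record
      { mgu         = ρ ⨾ mgu
      ; unifies     = head-unified ∷ Equivalence.to (Unifies-⟦⟧ E) unifies
      ; mostGeneral = λ θ → λ { (θx≡θt ∷ θ-unifies) →
          ⊑-⨾ {ρ = ρ} (↦-⊑ x t θx≡θt) (mostGeneral θ (⊑-Unifies-⟦⟧ E (↦-⊑ x t θx≡θt) θ-unifies)) }
      ; support     = λ y∉V → trans (cong (app mgu) (↦-other t (x≢ y∉V))) (support (y∉V ∘ proj₁ ∘ ∈-filter⁻ _))
      }
      where
      ρ = x ↦ t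
      V′ = filter (λ y → ¬? (y ≟ x)) V
      x∈V : x ∈ V
      x∈V = within (here (inj₁ here))
      x≢ : ∀ {y} → y ∉ V → x ≢ y
      x≢ y∉V refl = y∉V x∈V
      shorter : length V′ < length V
      shorter = filter-notAll _ V (Any.map (λ { refl y≢y → y≢y refl }) x∈V)
      vars′ : VarsWithin V′ (E ⟦ ρ ⟧)
      vars′ o with OccE-⟦⟧⁻ ρ E o
      ... | z , z∈E , y∈ρz with x ≟ z
      ... | yes refl = ∈-filter⁺ _ (within (here (inj₂ y∈ρz))) λ { refl → x∉t y∈ρz }
      ... | no x≢z with y∈ρz
      ...   | here = ∈-filter⁺ _ (within (there z∈E)) λ { refl → x≢z refl }
      open MGUWithin (recurse (E ⟦ ρ ⟧) shorter vars′ (⊑-Unifies-⟦⟧ E (↦-⊑ x t τx≡τt) τ-unifies))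
      head-unified : app mgu (ρ x) ≡ app (ρ ⨾ mgu) t
      head-unified = begin
        app mgu (ρ x)          ≡⟨ cong (app mgu) (↦-same x t) ⟩
        app mgu t              ≡⟨ cong (app mgu) (app-↦-fresh t t x∉t) ⟨
        app mgu (app ρ t)      ≡⟨ app-⨾ ρ mgu t ⟨
        app (ρ ⨾ mgu) t        ∎
        where open ≡-Reasoning

    solveVar : ∀ {V E} x t →
      (∀ {V′} E′ → length V′ < length V → VarsWithin V′ E′ → τ Unifies E′ → MGUWithin V′ E′) →
      (VarsWithin V E → τ Unifies E → MGUWithin V E) →
      VarsWithin V ((var x , t) ∷ E) → τ Unifies (var x , t) ∷ E → MGUWithin V ((var x , t) ∷ E)
    solveVar {E = E} x t recurse tail within (τx≡τt ∷ τ-unifies) with Occ? x t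
    ... | no x∉t = eliminate x∉t within (τx≡τt ∷ τ-unifies) recurse
    ... | yes x∈t with occurs-check τ x∈t τx≡τt
    ...   | refl = MGUWithin-⇔ (λ _ → Unifies-delete (var x) E) (tail (within ∘ there) τ-unifies)

    _⊏_ : ℕ × ℕ → ℕ × ℕ → Set
    _⊏_ = ×-Lex _≡_ _<_ _<_

    unify : ∀ V E → Acc _⊏_ (length V , sizeE E) → VarsWithin V E → τ Unifies E → MGUWithin V E
    unify V [] _ _ _ = MGUWithin-[]
    unify V ((var x , t) ∷ E) (acc rec) =
      solveVar x t (λ E′ shorter → unify _ E′ (rec (inj₁ shorter)))
                   (unify V E (rec (inj₂ (refl , sizeE-tail (var x) t E))))
    unify V ((fun f ss , var y) ∷ E) (acc rec) within τ-unifies =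
      MGUWithin-⇔ (λ _ → Unifies-swap (var y) (fun f ss) E)
        (solveVar y (fun f ss) (λ E′ shorter → unify _ E′ (rec (inj₁ shorter)))
                               (unify V E (rec (inj₂ (refl , sizeE-tail (fun f ss) (var y) E))))
                               (within ∘ OccE-swap (fun f ss) (var y) E)
                               (Equivalence.from (Unifies-swap (var y) (fun f ss) E) τ-unifies))
    unify V ((fun f ss , fun g ts) ∷ E) (acc rec) within (τf≡τg ∷ τ-unifies) with fun-injectiveˡ τf≡τg
    ... | refl =
      MGUWithin-⇔ (λ _ → Unifies-decompose ss ts E)
        (unify V (zipEq ss ts ++ E) (rec (inj₂ (refl , sizeE-decompose ss ts E)))
               (within ∘ OccE-decompose ss ts E)
               (Equivalence.from (Unifies-decompose ss ts E) (τf≡τg ∷ τ-unifies)))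

  unifier⇒mgu : ∀ (τ : ℕ → Term S) a b → app τ a ≡ app τ b →
    Σ (Subst S) λ σ → IsMGU σ a b × proj₁ σ ⊑ τ
  unifier⇒mgu τ a b τa≡τb =
    (mgu , bound V , λ y V≤y → support (λ y∈V → <⇒≱ (∈⇒<bound y∈V) V≤y)) ,
    (All.head unifies , λ θ θa≡θb → θ , mostGeneral (proj₁ θ) (θa≡θb ∷ [])) ,
    mostGeneral τ (τa≡τb ∷ [])
    where
    V = vars a ++ vars b
    E = (a , b) ∷ []
    varsE : VarsWithin V E
    varsE (here (inj₁ o)) = ∈-++⁺ˡ (Occ⇒∈vars a o)
    varsE (here (inj₂ o)) = ∈-++⁺ʳ (vars a) (Occ⇒∈vars b o)
    open MGUWithin (Unify.unify τ V E (×-wellFounded <-wellFounded <-wellFounded _) varsE (τa≡τb ∷ []))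

  Below : ℕ → Term S → Set
  Below N t = ∀ {x} → Occ x t → x < N

  varsG : List (Term S) → List ℕ
  varsG = concatMap vars

  fresh : List (Term S) → ℕ
  fresh g = bound (varsG g)

  fresh-Below : ∀ g → All (Below (fresh g)) g
  fresh-Below g = All.tabulate λ t∈g o →
    ∈⇒<bound (Any.concat⁺ (Any.map⁺ (Any.map (λ { refl → Occ⇒∈vars _ o }) t∈g)))

  OccG-Below : ∀ {N x g} → All (Below N) g → OccG x g → x < N
  OccG-Below (t-below ∷ _) (here o) = t-below o
  OccG-Below (_ ∷ g-below) (there o) = OccG-Below g-below o

  splice : ℕ → (ℕ → Term S) → (ℕ → Term S) → ℕ → Term S
  splice M A B y with y <? M
  ... | yes _ = A y
  ... | no _ with y <? M + M
  ...   | yes _ = B (y ∸ M)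
  ...   | no _  = var y

  splice-lo : ∀ M A B {y} → y < M → splice M A B y ≡ A y
  splice-lo M A B {y} y<M with y <? M
  ... | yes _  = refl
  ... | no y≮M = ⊥-elim (y≮M y<M)

  splice-mid : ∀ M A B {y} → y < M → splice M A B (y + M) ≡ B y
  splice-mid M A B {y} y<M with y + M <? M
  ... | yes y+M<M = ⊥-elim (<⇒≱ y+M<M (m≤n+m M y))
  ... | no _ with y + M <? M + M
  ...   | yes _       = cong B (m+n∸n≡m y M)
  ...   | no y+M≮M+M = ⊥-elim (y+M≮M+M (+-monoˡ-< M y<M))

  splice-hi : ∀ M A B {y} → M + M ≤ y → splice M A B y ≡ var y
  splice-hi M A B {y} M+M≤y with y <? M
  ... | yes y<M = ⊥-elim (<⇒≱ y<M (≤-trans (m≤m+n M M) M+M≤y))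
  ... | no _ with y <? M + M
  ...   | yes y<M+M = ⊥-elim (<⇒≱ y<M+M M+M≤y)
  ...   | no _      = refl

  spliceˢ : ℕ → (ℕ → Term S) → (ℕ → Term S) → Subst S
  spliceˢ M A B = splice M A B , M + M , λ y → splice-hi M A B

  swapBlocks : ℕ → ℕ → Term S
  swapBlocks M = splice M (λ y → var (y + M)) var

  swapBlocks-lo : ∀ M {y} → y < M → swapBlocks M y ≡ var (y + M)
  swapBlocks-lo M = splice-lo M _ var

  swapBlocks-mid : ∀ M {y} → y < M → swapBlocks M (y + M) ≡ var y
  swapBlocks-mid M = splice-mid M _ var

  swapBlocks-involutive : ∀ M y → app (swapBlocks M) (swapBlocks M y) ≡ var y
  swapBlocks-involutive M y with M ≤? y
  ... | no M≰y = trans (cong (app (swapBlocks M)) (swapBlocks-lo M y<M)) (swapBlocks-mid M y<M)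
    where
    y<M = ≰⇒> M≰y
  ... | yes M≤y with M + M ≤? y
  ...   | no M+M≰y = subst (λ w → app (swapBlocks M) (swapBlocks M w) ≡ var w) (m∸n+n≡m M≤y)
                        (trans (cong (app (swapBlocks M)) (swapBlocks-mid M y∸M<M)) (swapBlocks-lo M y∸M<M))
    where
    y∸M<M : y ∸ M < M
    y∸M<M = +-cancelʳ-< M (y ∸ M) M (subst (_< M + M) (sym (m∸n+n≡m M≤y)) (≰⇒> M+M≰y))
  ...   | yes M+M≤y = trans (cong (app (swapBlocks M)) fixed) fixed
    where
    fixed : swapBlocks M y ≡ var y
    fixed = splice-hi M _ var M+M≤y

  swapBlocksˢ : ℕ → Subst S
  swapBlocksˢ M = spliceˢ M (λ y → var (y + M)) var

  involution⇒IsRenaming : ∀ (γ : Subst S) → (∀ t → t ⟨ γ ⟩ ⟨ γ ⟩ ≡ t) → IsRenaming γ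
  involution⇒IsRenaming γ involutive =
    (λ s t eq → trans (sym (involutive s)) (trans (cong (_⟨ γ ⟩) eq) (involutive t))) ,
    (λ t → t ⟨ γ ⟩ , involutive t)

  swapBlocks-IsRenaming : ∀ M → IsRenaming {S} (swapBlocksˢ M)
  swapBlocks-IsRenaming M = involution⇒IsRenaming (swapBlocksˢ M) λ t → begin
    app ρ (app ρ t)   ≡⟨ app-⨾ ρ ρ t ⟨
    app (ρ ⨾ ρ) t     ≡⟨ app-cong t (λ {y} _ → swapBlocks-involutive M y) ⟩
    app var t         ≡⟨ app-var t ⟩
    t                 ∎
    where
    open ≡-Reasoning
    ρ : ℕ → Term S
    ρ = swapBlocks M

  splice-app-lo : ∀ M A B {a} → Below M a → app (splice M A B) a ≡ app A a
  splice-app-lo M A B {a} a-below = app-cong a (λ o → splice-lo M A B (a-below o))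

  splice-app-mid : ∀ M A B {a} → Below M a → app (splice M A B) (app (swapBlocks M) a) ≡ app B a
  splice-app-mid M A B {a} a-below = trans (sym (app-⨾ (swapBlocks M) (splice M A B) a))
    (app-cong a (λ {y} o → trans (cong (app (splice M A B)) (swapBlocks-lo M (a-below o))) (splice-mid M A B (a-below o))))

  swapped-above : ∀ M {a x} → Below M a → Occ x (app (swapBlocks M) a) → M ≤ x
  swapped-above M {a} a-below o with Occ-app⁻ (swapBlocks M) a o
  ... | z , z∈a , x∈ρz with subst (Occ _) (swapBlocks-lo M (a-below z∈a)) x∈ρz
  ...   | here = m≤n+m M z

  swappedG-above : ∀ M {g x} → All (Below M) g → OccG x (map (app (swapBlocks M)) g) → M ≤ x
  swappedG-above M (t-below ∷ _) (here o)  = swapped-above M t-below o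
  swappedG-above M (_ ∷ g-below) (there o) = swappedG-above M g-below o

  map-app-⨾ : ∀ (σ θ : ℕ → Term S) g → map (app (σ ⨾ θ)) g ≡ map (app θ) (map (app σ) g)
  map-app-⨾ σ θ g = trans (map-cong (app-⨾ σ θ) g) (map-∘ g)

  map-splice-lo : ∀ M A B {g} → All (Below M) g → map (app (splice M A B)) g ≡ map (app A) g
  map-splice-lo M A B g-below = map-cong-local (All.map (splice-app-lo M A B) g-below)

  map-splice-mid : ∀ M A B {g} → All (Below M) g →
    map (app (splice M A B)) (map (app (swapBlocks M)) g) ≡ map (app B) g
  map-splice-mid M A B {g} g-below =
    trans (sym (map-∘ g)) (map-cong-local (All.map (splice-app-mid M A B) g-below))

  splice-unifies : ∀ M (θ γ σ : ℕ → Term S) {a b} → Below M a → Below M b →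
    app σ (app θ a) ≡ app σ (app γ b) →
    app (splice M (θ ⨾ σ) (γ ⨾ σ)) a ≡ app (splice M (θ ⨾ σ) (γ ⨾ σ)) (app (swapBlocks M) b)
  splice-unifies M θ γ σ {a} {b} a-below b-below σθa≡σγb = begin
    app τ a                       ≡⟨ splice-app-lo M _ _ a-below ⟩
    app (θ ⨾ σ) a                 ≡⟨ app-⨾ θ σ a ⟩
    app σ (app θ a)               ≡⟨ σθa≡σγb ⟩
    app σ (app γ b)               ≡⟨ app-⨾ γ σ b ⟨
    app (γ ⨾ σ) b                 ≡⟨ splice-app-mid M _ _ b-below ⟨
    app τ (app (swapBlocks M) b)  ∎
    where
    open ≡-Reasoning
    τ : ℕ → Term S
    τ = splice M (θ ⨾ σ) (γ ⨾ σ)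

  map-app-splice : ∀ M (θ γ σ : ℕ → Term S) {g₁ vs g₂} →
    All (Below M) g₁ → All (Below M) vs → All (Below M) g₂ →
    map (app σ) (map (app θ) g₁ ++ map (app γ) vs ++ map (app θ) g₂)
      ≡ map (app (splice M (θ ⨾ σ) (γ ⨾ σ))) (g₁ ++ map (app (swapBlocks M)) vs ++ g₂)
  map-app-splice M θ γ σ {g₁} {vs} {g₂} g₁-below vs-below g₂-below = begin
    map (app σ) (map (app θ) g₁ ++ map (app γ) vs ++ map (app θ) g₂)
      ≡⟨ map-++₃ _ (map (app θ) g₁) (map (app γ) vs) (map (app θ) g₂) ⟩
    map (app σ) (map (app θ) g₁) ++ map (app σ) (map (app γ) vs) ++ map (app σ) (map (app θ) g₂)
      ≡⟨ cong₂ _++_ (old-variables g₁-below) (cong₂ _++_ renamed-variables (old-variables g₂-below)) ⟩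
    map (app τ) g₁ ++ map (app τ) (map (app (swapBlocks M)) vs) ++ map (app τ) g₂
      ≡⟨ map-++₃ _ g₁ (map (app (swapBlocks M)) vs) g₂ ⟨
    map (app τ) (g₁ ++ map (app (swapBlocks M)) vs ++ g₂) ∎
    where
    open ≡-Reasoning
    τ : ℕ → Term S
    τ = splice M (θ ⨾ σ) (γ ⨾ σ)
    old-variables : ∀ {g} → All (Below M) g → map (app σ) (map (app θ) g) ≡ map (app τ) g
    old-variables {g} g-below = trans (sym (map-app-⨾ θ σ g)) (sym (map-splice-lo M _ _ g-below))
    renamed-variables : map (app σ) (map (app γ) vs) ≡ map (app τ) (map (app (swapBlocks M)) vs)
    renamed-variables = trans (sym (map-app-⨾ γ σ vs)) (sym (map-splice-mid M _ _ vs-below))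

  ⇝-compatible-mg : (r : Rule S) (s s′ t : List (Term S)) → s′ ∈mg s → r ⊢ s ⇝ t →
    ∃ λ (t′ : List (Term S)) → t′ ∈mg t × r ⊢ s′ ⇝ t′
  ⇝-compatible-mg (u , vs) _ _ _ ((pre′ , post′) , g , ((θ , _) , refl) , refl)
      (_ , _ , _ , _ , gθ≡ , _ , (γ , _) , _ , _ , (σ , _) , (σ-unifies , _) , refl)
    with map-≡-++-∷ (app θ) g gθ≡
  ... | g₁ , gᵢ , g₂ , refl , refl , refl , refl =
    t′ , ((pre′ ⟪ σ′ ⟫ , post′ ⟪ σ′ ⟫) , Y ⟪ σ′ ⟫ , (τˢ , t≡Y⟪σ′⟫⟪τ⟫) , t′≡) ,
    length (pre′ ++ g₁) + 1 , pre′ ++ g₁ , gᵢ , g₂ ++ post′ , sym (++-reassoc pre′ g₁ [ gᵢ ] g₂ post′) , refl ,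
    swapBlocksˢ M , swapBlocks-IsRenaming M , disjoint , σ′ , σ′-mgu , refl
    where
    s′ = pre′ ++ (g₁ ++ gᵢ ∷ g₂) ++ post′
    M = fresh (s′ ++ u ∷ vs)
    s′-below : All (Below M) s′
    s′-below = All.++⁻ˡ s′ (fresh-Below (s′ ++ u ∷ vs))
    rule-below : All (Below M) (u ∷ vs)
    rule-below = All.++⁻ʳ s′ (fresh-Below (s′ ++ u ∷ vs))
    g-below : All (Below M) (g₁ ++ gᵢ ∷ g₂)
    g-below = All.++⁻ˡ (g₁ ++ gᵢ ∷ g₂) (All.++⁻ʳ pre′ s′-below)
    gᵢ∷g₂-below = All.++⁻ʳ g₁ g-below

    ρ τ : ℕ → Term S
    ρ = swapBlocks M
    τ = splice M (θ ⨾ σ) (γ ⨾ σ)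
    τˢ = spliceˢ M (θ ⨾ σ) (γ ⨾ σ)

    mgu = unifier⇒mgu τ gᵢ (app ρ u) (splice-unifies M θ γ σ (All.head gᵢ∷g₂-below) (All.head rule-below) σ-unifies)
    σ′ = proj₁ mgu
    σ′-mgu = proj₁ (proj₂ mgu)

    W = map (app ρ) vs
    Y = g₁ ++ W ++ g₂
    t′ = ((pre′ ++ g₁) ++ W ++ (g₂ ++ post′)) ⟪ σ′ ⟫

    t′≡ : t′ ≡ pre′ ⟪ σ′ ⟫ ++ Y ⟪ σ′ ⟫ ++ post′ ⟪ σ′ ⟫
    t′≡ = trans (cong (map (app (proj₁ σ′))) (++-reassoc pre′ g₁ W g₂ post′)) (map-++₃ _ pre′ Y post′)

    t≡Y⟪σ′⟫⟪τ⟫ : map (app σ) (map (app θ) g₁ ++ map (app γ) vs ++ map (app θ) g₂) ≡ Y ⟪ σ′ ⟫ ⟪ τˢ ⟫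
    t≡Y⟪σ′⟫⟪τ⟫ = begin
      map (app σ) (map (app θ) g₁ ++ map (app γ) vs ++ map (app θ) g₂)
        ≡⟨ map-app-splice M θ γ σ (All.++⁻ˡ g₁ g-below) (All.tail rule-below) (All.tail gᵢ∷g₂-below) ⟩
      map (app τ) Y
        ≡⟨ map-cong (⊑-app (proj₂ (proj₂ mgu))) Y ⟨
      map (app τ ∘ app (proj₁ σ′)) Y
        ≡⟨ map-∘ Y ⟩
      Y ⟪ σ′ ⟫ ⟪ τˢ ⟫ ∎
      where open ≡-Reasoning

    disjoint : VarDisjoint (app ρ u , W) s′
    disjoint x x∈rule x∈s′ =
      <⇒≱ (OccG-Below s′-below x∈s′) (swappedG-above M rule-below (Sum.[ here , there ] x∈rule))

lemma3 : (S : Signature) (r : Rule S) →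
    (∀ (s s' t : Term S) → s' ∈ins s → r ⊢ s ⟶ t →
       ∃ λ (t' : Term S) → t' ∈ins t × r ⊢ s' ⟶ t') ×
    (∀ (s s' t : List (Term S)) → s' ∈mg s → r ⊢ s ⇝ t →
       ∃ λ (t' : List (Term S)) → t' ∈mg t × r ⊢ s' ⇝ t')
lemma3 S r = ⟶-compatible-ins r , ⇝-compatible-mg r
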